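{- Let $T$ be a Baxter tree-like tableau, and let $(L,R)$ be the partition of the non-root points of $T$ where $L$ (resp. $R$) consists of the points lying in the left (resp. right) subtree pending from the root of the underlying binary tree of $T$. Then every point of $L$ lies strictly to the left of and strictly below every point of $R$.
   Context: Ferrers diagrams are drawn in English notation. A tree-like tableau (TLT) is a nonempty Ferrers diagram each of whose cells is empty or pointed, such that: (1) the top-left cell is pointed (the root); (2) every non-root pointed cell $c$ has a pointed cell above it in its column or to its left in its row, but not both; the nearest such pointed cell is its parent; (3) every row and column contains a pointed cell. The underlying binary tree has the points as vertices, rooted at the root point; a point whose parent lies above it (same column) is the left child of its parent, and one whose parent lies to its left (same row) is the right child. A TLT contains pattern H if there are rows $r_1$ above $r_2$ and columns $c_1<c_2<c_3$ with all six cells $(r_a,c_b)$ in the diagram such that $(r_1,c_2),(r_2,c_1),(r_2,c_3)$ are pointed and $(r_1,c_3),(r_2,c_2)$ empty; pattern V if there are rows $r_1$ above $r_2$ above $r_3$ and columns $c_1<c_2$ with all six cells in the diagram such that $(r_1,c_2),(r_2,c_1),(r_3,c_2)$ are pointed and $(r_2,c_2),(r_3,c_1)$ empty. A Baxter TLT is a TLT containing neither H nor V. -}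

module Defs where

open import Data.Bool using (Bool; true; false)
open import Data.List using (List; []; _∷_; length)
open import Data.Nat using (ℕ; zero; suc; _<_; _≤_)
open import Data.Product using (_×_; _,_; ∃; ∃-syntax; Σ)
open import Data.Sum using (_⊎_)
open import Relation.Binary.PropositionalEquality using (_≡_; _≢_)
open import Relation.Nullary using (¬_)

-- A filled Ferrers diagram: list of rows (top to bottom, English notation),
-- each row a list of cells from left to right; true = pointed, false = empty.
-- Rows and columns are indexed from 0; row r is above row r' iff r < r'.
Filling : Set
Filling = List (List Bool)

rowAt : Filling → ℕ → List Bool
rowAt []       _       = []
rowAt (x ∷ _)  zero    = x
rowAt (_ ∷ xs) (suc r) = rowAt xs r

cellAt : List Bool → ℕ → Bool
cellAt []       _       = false
cellAt (b ∷ _)  zero    = b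
cellAt (_ ∷ bs) (suc c) = cellAt bs c

InD : Filling → ℕ → ℕ → Set
InD F r c = c < length (rowAt F r)

-- (r , c) is a pointed cell (necessarily in the diagram)
Pt : Filling → ℕ → ℕ → Set
Pt F r c = cellAt (rowAt F r) c ≡ true

Empty : Filling → ℕ → ℕ → Set
Empty F r c = InD F r c × cellAt (rowAt F r) c ≡ false

IsFerrers : Filling → Set
IsFerrers F =
  (0 < length F)
  × (∀ r → r < length F → 0 < length (rowAt F r))
  × (∀ r → length (rowAt F (suc r)) ≤ length (rowAt F r))

PtAbove : Filling → ℕ → ℕ → Set
PtAbove F r c = ∃[ r' ] (r' < r × Pt F r' c)

PtLeft : Filling → ℕ → ℕ → Set
PtLeft F r c = ∃[ c' ] (c' < c × Pt F r c')

IsRoot : ℕ → ℕ → Set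
IsRoot r c = (r ≡ 0) × (c ≡ 0)

record IsTLT (F : Filling) : Set where
  field
    ferrers  : IsFerrers F
    rootPt   : Pt F 0 0
    parentEx : ∀ r c → Pt F r c → ¬ IsRoot r c →
               (PtAbove F r c × ¬ PtLeft F r c) ⊎ (¬ PtAbove F r c × PtLeft F r c)
    rowsOk   : ∀ r → r < length F → ∃[ c ] Pt F r c
    colsOk   : ∀ c → c < length (rowAt F 0) → ∃[ r ] Pt F r c

ContainsH : Filling → Set
ContainsH F = Σ ℕ λ r₁ → Σ ℕ λ r₂ → Σ ℕ λ c₁ → Σ ℕ λ c₂ → Σ ℕ λ c₃ →
  r₁ < r₂ × c₁ < c₂ × c₂ < c₃
  × (InD F r₁ c₁ × InD F r₁ c₂ × InD F r₁ c₃ × InD F r₂ c₁ × InD F r₂ c₂ × InD F r₂ c₃)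
  × Pt F r₁ c₂ × Pt F r₂ c₁ × Pt F r₂ c₃
  × Empty F r₁ c₃ × Empty F r₂ c₂

ContainsV : Filling → Set
ContainsV F = Σ ℕ λ r₁ → Σ ℕ λ r₂ → Σ ℕ λ r₃ → Σ ℕ λ c₁ → Σ ℕ λ c₂ →
  r₁ < r₂ × r₂ < r₃ × c₁ < c₂
  × (InD F r₁ c₁ × InD F r₁ c₂ × InD F r₂ c₁ × InD F r₂ c₂ × InD F r₃ c₁ × InD F r₃ c₂)
  × Pt F r₁ c₂ × Pt F r₂ c₁ × Pt F r₃ c₂
  × Empty F r₂ c₂ × Empty F r₃ c₁

IsBaxterTLT : Filling → Set
IsBaxterTLT F = IsTLT F × ¬ ContainsH F × ¬ ContainsV F

Point : Set
Point = ℕ × ℕ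

-- (r' , c) is the nearest pointed cell above the pointed cell (r , c):
-- (r , c) is the LEFT child of (r' , c) in the underlying binary tree
-- (when (r , c) is a non-root point of a TLT).
AboveParent : Filling → Point → Point → Set
AboveParent F (r' , c') (r , c) =
  c' ≡ c × r' < r × Pt F r' c × Pt F r c × ¬ IsRoot r c
  × (∀ k → r' < k → k < r → ¬ Pt F k c)

-- (r , c') is the nearest pointed cell left of the pointed cell (r , c):
-- (r , c) is the RIGHT child of (r , c').
LeftParent : Filling → Point → Point → Set
LeftParent F (r' , c') (r , c) =
  r' ≡ r × c' < c × Pt F r c' × Pt F r c × ¬ IsRoot r c
  × (∀ k → c' < k → k < c → ¬ Pt F r k)

Parent : Filling → Point → Point → Set
Parent F p q = AboveParent F p q ⊎ LeftParent F p q

data Desc (F : Filling) : Point → Point → Set where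
  here  : ∀ {p} → Desc F p p
  there : ∀ {p q s} → Parent F p q → Desc F q s → Desc F p s

root : Point
root = (0 , 0)

InL : Filling → Point → Set
InL F q = ∃[ a ] (AboveParent F root a × Desc F a q)

InR : Filling → Point → Set
InR F q = ∃[ a ] (LeftParent F root a × Desc F a q)

{-# OPTIONS --safe #-}
module Submission where

-- Let (a , 0) and (0 , b) be the two children of the root. The region of rows
-- above a and columns right of 0 is closed under taking children: a left child
-- (r₂ , c) of (r , c) cannot land in row a, where (a , 0) would give it a
-- second parent, nor below it, where rows r < a < r₂ and columns 0 < c form a
-- V. So the right subtree stays above row a, while the left subtree starts in
-- row a and only moves down. Transposing the argument (H instead of V) gives
-- the column statement.

open import Defs
open import Data.Nat using (zero; suc; _<_; _≤_; _≤′_; ≤′-refl; ≤′-step; z≤n; s≤s)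
open import Data.Nat.Properties
  using (≤-refl; ≤-trans; <-trans; <⇒≤; <-≤-trans; ≤-<-trans; <-cmp; ≤⇒≤′)
open import Data.Bool.Properties using (¬-not)
open import Data.List using (List; _∷_; length)
open import Data.Bool using (Bool; true)
open import Data.Product using (_×_; _,_; proj₁; proj₂)
open import Data.Sum using (inj₁; inj₂)
open import Data.Empty using (⊥-elim)
open import Relation.Nullary using (¬_)
open import Relation.Binary.Definitions using (tri<; tri≈; tri>)
open import Relation.Binary.PropositionalEquality using (_≡_; refl)

cellAt-true⇒<length : ∀ (bs : List Bool) c → cellAt bs c ≡ true → c < length bs
cellAt-true⇒<length (_ ∷ _)  zero _ = s≤s z≤n
cellAt-true⇒<length (_ ∷ bs) (suc c) h = s≤s (cellAt-true⇒<length bs c h)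

module _ {P : Point → Set} {F : Filling}
         (step : ∀ {x y} → Parent F x y → P x → P y) where

  Desc-preserves : ∀ {x y} → Desc F x y → P x → P y
  Desc-preserves here        px = px
  Desc-preserves (there e d) px = Desc-preserves d (step e px)

Desc⇒below-right : ∀ {F x y} → Desc F x y → proj₁ x ≤ proj₁ y × proj₂ x ≤ proj₂ y
Desc⇒below-right here = ≤-refl , ≤-refl
Desc⇒below-right (there (inj₁ (refl , r<r′ , _)) d) =
  let (r≤ , c≤) = Desc⇒below-right d in ≤-trans (<⇒≤ r<r′) r≤ , c≤
Desc⇒below-right (there (inj₂ (refl , c<c′ , _)) d) =
  let (r≤ , c≤) = Desc⇒below-right d in r≤ , ≤-trans (<⇒≤ c<c′) c≤

module _ {F : Filling} (T : IsTLT F) where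
  open IsTLT T

  rowLength-antitone : ∀ {r′ r} → r′ ≤ r → length (rowAt F r) ≤ length (rowAt F r′)
  rowLength-antitone r′≤r = go (≤⇒≤′ r′≤r)
    where
      go : ∀ {r′ r} → r′ ≤′ r → length (rowAt F r) ≤ length (rowAt F r′)
      go ≤′-refl       = ≤-refl
      go (≤′-step r′≤r) = ≤-trans (proj₂ (proj₂ ferrers) _) (go r′≤r)

  InD-downClosed : ∀ {r c r′ c′} → InD F r c → r′ ≤ r → c′ ≤ c → InD F r′ c′
  InD-downClosed rc r′≤r c′≤c = <-≤-trans (≤-<-trans c′≤c rc) (rowLength-antitone r′≤r)

  Pt⇒InD : ∀ {r c} → Pt F r c → InD F r c
  Pt⇒InD {r} {c} = cellAt-true⇒<length (rowAt F r) c

  ¬PtAbove×PtLeft : ∀ {r c} → Pt F r c → ¬ IsRoot r c → PtAbove F r c → ¬ PtLeft F r c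
  ¬PtAbove×PtLeft rc nr above left with parentEx _ _ rc nr
  ... | inj₁ (_ , ¬left)  = ¬left left
  ... | inj₂ (¬above , _) = ¬above above

  leftChild-row< : ¬ ContainsV F → ∀ {a r c r₂} → Pt F a 0 → AboveParent F (r , c) (r₂ , c) →
                   r < a → 0 < c → r₂ < a
  leftChild-row< noV {a} {r} {c} {r₂} a0 (_ , r<r₂ , rc , r₂c , nr , gap) r<a 0<c
    with <-cmp r₂ a
  ... | tri< r₂<a _ _ = r₂<a
  ... | tri≈ _ refl _ = ⊥-elim (¬PtAbove×PtLeft r₂c nr (r , r<r₂ , rc) (0 , 0<c , a0))
  ... | tri> _ _ a<r₂ = ⊥-elim (noV (r , a , r₂ , 0 , c , r<a , a<r₂ , 0<c ,
      (inD (<⇒≤ r<r₂) z≤n , inD (<⇒≤ r<r₂) ≤-refl , inD (<⇒≤ a<r₂) z≤n ,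
       inD (<⇒≤ a<r₂) ≤-refl , inD ≤-refl z≤n , Pt⇒InD r₂c) ,
      rc , a0 , r₂c ,
      (inD (<⇒≤ a<r₂) ≤-refl , ¬-not (gap a r<a a<r₂)) ,
      (inD ≤-refl z≤n , ¬-not λ r₂0 → ¬PtAbove×PtLeft r₂c nr (r , r<r₂ , rc) (0 , 0<c , r₂0))))
    where
      inD : ∀ {r′ c′} → r′ ≤ r₂ → c′ ≤ c → InD F r′ c′
      inD = InD-downClosed (Pt⇒InD r₂c)

  rightChild-column< : ¬ ContainsH F → ∀ {b r c c₂} → Pt F 0 b → LeftParent F (r , c) (r , c₂) →
                       c < b → 0 < r → c₂ < b
  rightChild-column< noH {b} {r} {c} {c₂} 0b (_ , c<c₂ , rc , rc₂ , nr , gap) c<b 0<r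
    with <-cmp c₂ b
  ... | tri< c₂<b _ _ = c₂<b
  ... | tri≈ _ refl _ = ⊥-elim (¬PtAbove×PtLeft rc₂ nr (0 , 0<r , 0b) (c , c<c₂ , rc))
  ... | tri> _ _ b<c₂ = ⊥-elim (noH (0 , r , c , b , c₂ , 0<r , c<b , b<c₂ ,
      (inD z≤n (<⇒≤ c<c₂) , inD z≤n (<⇒≤ b<c₂) , inD z≤n ≤-refl ,
       inD ≤-refl (<⇒≤ c<c₂) , inD ≤-refl (<⇒≤ b<c₂) , Pt⇒InD rc₂) ,
      0b , rc , rc₂ ,
      (inD z≤n ≤-refl , ¬-not λ 0c₂ → ¬PtAbove×PtLeft rc₂ nr (0 , 0<r , 0c₂) (c , c<c₂ , rc)) ,
      (inD ≤-refl (<⇒≤ b<c₂) , ¬-not (gap b c<b b<c₂))))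
    where
      inD : ∀ {r′ c′} → r′ ≤ r → c′ ≤ c₂ → InD F r′ c′
      inD = InD-downClosed (Pt⇒InD rc₂)

  Desc-row< : ¬ ContainsV F → ∀ {a x y} → Pt F a 0 → Desc F x y →
              proj₁ x < a → 0 < proj₂ x → proj₁ y < a
  Desc-row< noV {a} a0 d r<a 0<c = proj₁ (Desc-preserves step d (r<a , 0<c))
    where
      step : ∀ {x y} → Parent F x y → proj₁ x < a × 0 < proj₂ x → proj₁ y < a × 0 < proj₂ y
      step (inj₁ e@(refl , _))        (r<a , 0<c) = leftChild-row< noV a0 e r<a 0<c , 0<c
      step (inj₂ (refl , c<c₂ , _)) (r<a , 0<c) = r<a , <-trans 0<c c<c₂

  Desc-column< : ¬ ContainsH F → ∀ {b x y} → Pt F 0 b → Desc F x y →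
                 proj₂ x < b → 0 < proj₁ x → proj₂ y < b
  Desc-column< noH {b} 0b d c<b 0<r = proj₁ (Desc-preserves step d (c<b , 0<r))
    where
      step : ∀ {x y} → Parent F x y → proj₂ x < b × 0 < proj₁ x → proj₂ y < b × 0 < proj₁ y
      step (inj₁ (refl , r<r₂ , _)) (c<b , 0<r) = c<b , <-trans 0<r r<r₂
      step (inj₂ e@(refl , _))        (c<b , 0<r) = rightChild-column< noH 0b e c<b 0<r , 0<r

proposition2p8 : (F : Filling) → IsBaxterTLT F →
    (p q : Point) → InL F p → InR F q →
    (proj₂ p < proj₂ q) × (proj₁ q < proj₁ p)
proposition2p8 F (T , noH , noV) p q
  ((a , _) , (refl , 0<a , _ , a0 , _) , a↝p) ((_ , b) , (refl , 0<b , _ , 0b , _) , b↝q) =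
  <-≤-trans (Desc-column< T noH 0b a↝p 0<b 0<a) (proj₂ (Desc⇒below-right b↝q)) ,
  <-≤-trans (Desc-row< T noV a0 b↝q 0<a 0<b) (proj₁ (Desc⇒below-right a↝p))
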